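{- Let $e$ be any reducible event. Then for every static formula $\theta$ (of $LKV$) and every static term $x$ (of $LKV$), the formula $[e]\theta$ and the term $e(x)$ are reducible.
   Context: Vocabulary: agents $\mathcal A$; constants $C$ containing $0,1$ and an "undefined" constant $\uparrow$; basic local variables $V$, each owned by an agent ($v_a$ owned by $a$); predicate symbols (including binary $=$) and function symbols with arities. Groups: finite non-empty $A\subseteq\mathcal A$; supergroups: finite non-empty sets $\mathfrak A$ of groups. Syntax of $DLKV$: terms $x::= c\mid v\mid x|_\varphi y\mid F(x_1,\dots,x_n)\mid x_A^\varphi\mid e(x)$; formulas $\varphi::=Px_1\dots x_n\mid\neg\varphi\mid\varphi\wedge\varphi\mid K_A\varphi\mid C_{\mathfrak A}^\theta\varphi\mid[e]\varphi$; events $e::=!\Phi/\sigma$, $\Phi$ a finite set of formulas, $\sigma$ assigning to each $v\in V$ a term $\sigma(v)$ and to each agent $a$ a set of agents $\sigma(a)$ with $a\in\sigma(a)$ and $K_a\sigma(v_a)\in\Phi$. $pre_e:=\bigwedge\Phi$, $e(a):=\sigma(a)$, $post_e(v):=\sigma(v)$, $e(A):=\bigcup_{a\in A}e(a)$, $e[\mathfrak A]:=\{e(A):A\in\mathfrak A\}$. The static fragment $LKV$ omits $[e]\varphi$ and $e(x)$. Reducibility: a $DLKV$-formula $\theta$ is reducible if $\theta\leftrightarrow\theta'$ is provable in $\mathbf{DLKV}$ for some $LKV$-formula $\theta'$; a $DLKV$-term $x$ is reducible if $x=x'$ is provable in $\mathbf{DLKV}$ for some $LKV$-term $x'$; an event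 $e=!\Phi/\sigma$ is reducible if all formulas in $\Phi$ and all terms $\sigma(v)$ ($v\in V$) are reducible. Abbreviations: $\top:=(\uparrow=\uparrow)$, $x\!\uparrow:=(x=\uparrow)$, $x\!\downarrow:=\neg x\!\uparrow$; $\overline x=\overline y$ is $\bigwedge_ix_i=y_i$; $K_a:=K_{\{a\}}$; $K_A^\theta\varphi:=K_A(\theta\to\varphi)$; $K_A^\theta x:=K_A^\theta(x=x_A^\theta)$; $K_A^\theta\overline x:=\bigwedge_iK_A^\theta x_i$; $K_Ax:=K_A^\top x$; $\langle K_A\rangle\varphi:=\neg K_A\neg\varphi$; $\langle e\rangle\varphi:=\neg[e]\neg\varphi$. Proof system $\mathbf{DLKV}$: (I) classical propositional tautologies and modus ponens. (II) $x=x$; $\overline x=\overline y\to(P\overline x\,\overline z\leftrightarrow P\overline y\,\overline z)$; $\overline x=\overline y\to F(\overline x)=F(\overline y)$; $(\varphi\to x|_\varphi y=x)\wedge(\neg\varphi\to x|_\varphi y=y)$. (III) from $\varphi$ infer $K_A\varphi$; $K_A(\varphi\to\psi)\to(K_A\varphi\to K_A\psi)$; $K_A\varphi\to\varphi$; $K_A\varphi\to K_AK_A\varphi$; $\neg K_A\varphi\to K_A\neg K_A\varphi$; $K_A\varphi\to K_B\varphi$ if $A\subseteq B$. (IV) from $\varphi$ infer $C_{\mathfrak A}^\theta\varphi$; $C_{\mathfrak A}^\theta(\varphi\to\psi)\to(C_{\mathfrak A}^\theta\varphi\to C_{\mathfrak A}^\theta\psi)$; $C_{\mathfrak A}^\theta\varphi\to(\varphi\wedge\bigwedge_{A\in\mathfrak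 A}K_A^\theta C_{\mathfrak A}^\theta\varphi)$; $C_{\mathfrak A}^\theta(\varphi\to\bigwedge_{A\in\mathfrak A}K_A^\theta\varphi)\to(\varphi\to C_{\mathfrak A}^\theta\varphi)$. (V) $x_A^\varphi\!\downarrow\to(K_A^\varphi x\wedge\langle K_A\rangle\varphi)$; $K_ac\wedge K_av_a$; $K_Ax_A^\varphi$; $K_A\overline x\to(P\overline x\to K_AP\overline x)$; $K_A^\varphi\overline x\to K_A^\varphi F(\overline x)$; $K_A^\theta(x=y)\to(K_A^\theta x\to K_A^\theta y)$; $K_A(\varphi\to\theta)\to(K_A^\theta x\to K_A^\varphi x)$. (VI) from $\varphi$ infer $[e]\varphi$; $[e](\varphi\to\psi)\to([e]\varphi\to[e]\psi)$; $[e]Px_1\dots x_n\leftrightarrow(pre_e\to Pe(x_1)\dots e(x_n))$; $[e]\neg\varphi\leftrightarrow(pre_e\to\neg[e]\varphi)$; $[e]K_A\varphi\leftrightarrow(pre_e\to K_{e(A)}[e]\varphi)$; $[e]C_{\mathfrak A}^\theta\varphi\leftrightarrow(pre_e\to C_{e[\mathfrak A]}^{\langle e\rangle\theta}[e]\varphi)$. (VII) $e(x)\!\downarrow\to pre_e$; $pre_e\to e(c)=c$; $pre_e\to e(v)=post_e(v)$; $pre_e\to e(x|_\varphi y)=e(x)|_{\langle e\rangle\varphi}e(y)$; $pre_e\to e(F(x_1,\dots,x_n))=F(e(x_1),\dots,e(x_n))$; $pre_e\to e(x_A^\varphi)=e(x)_{e(A)}^{\langle e\rangle\varphi}$. -}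

module Defs where

open import Data.Nat using (ℕ; _+_)
open import Data.Bool using (Bool; true; false; not; _∧_)
open import Data.Product using (Σ; _×_; _,_)
open import Data.List using (List; []; _∷_)
open import Data.List.NonEmpty as L⁺ using (List⁺; [_])
open import Data.List.Membership.Propositional using (_∈_)
open import Data.List.Relation.Binary.Subset.Propositional using (_⊆_)
open import Data.List.Relation.Unary.All using (All)
open import Data.Vec as Vec using (Vec; _++_)
open import Data.Vec.Relation.Unary.All as VAll using ()
open import Relation.Binary.PropositionalEquality using (_≡_)

record Vocab : Set₁ where
  field
    Agent  : Set
    Const  : Set
    c0 c1  : Const
    cundef : Const
    Var    : Set
    owner  : Var → Agent
    Pred   : ℕ → Set
    eqP    : Pred 2
    Func   : ℕ → Set

module Syntax (𝒱 : Vocab) where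
  open Vocab 𝒱

  -- groups: finite non-empty sets of agents; supergroups: finite non-empty
  -- sets of groups (represented by non-empty lists)
  Group : Set
  Group = List⁺ Agent

  SuperGroup : Set
  SuperGroup = List⁺ Group

  data Term    : Set
  data Formula : Set
  data Event   : Set

  infixl 6 _∧ᶠ_

  data Term where
    const : Const → Term
    var   : Var → Term
    cond  : Term → Formula → Term → Term
    fun   : ∀ {n} → Func n → Vec Term n → Term
    restr : Term → Group → Formula → Term
    app   : Event → Term → Term

  data Formula where
    pred  : ∀ {n} → Pred n → Vec Term n → Formula
    ¬ᶠ_   : Formula → Formula
    _∧ᶠ_  : Formula → Formula → Formula
    K     : Group → Formula → Formula
    C     : SuperGroup → Formula → Formula → Formula
    box   : Event → Formula → Formula

  -- an event !Φ/σ.  The last field says K_a σ(v_a) ∈ Φ, where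
  -- K_a x = K_{a}(⊤ → x = x_{a}^⊤), ⊤ = (↑ = ↑), φ → ψ = ¬(φ ∧ ¬ψ).
  data Event where
    mkEvent : (Φ : List Formula)
            → (σv : Var → Term)
            → (σa : Agent → Group)
            → (∀ a → a ∈ L⁺.toList (σa a))
            → (∀ v → K [ owner v ]
                       (¬ᶠ (pred eqP (const cundef Vec.∷ const cundef Vec.∷ Vec.[])
                            ∧ᶠ ¬ᶠ pred eqP (σv v Vec.∷
                                    restr (σv v) [ owner v ]
                                      (pred eqP (const cundef Vec.∷ const cundef Vec.∷ Vec.[]))
                                    Vec.∷ Vec.[])))
                     ∈ Φ)
            → Event

  infixr 4 _⇒_
  infix 5 _⇔_
  infix 7 _≐_

  _≐_ : Term → Term → Formula
  x ≐ y = pred eqP (x Vec.∷ y Vec.∷ Vec.[])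

  ↑ : Term
  ↑ = const cundef

  ⊤ᶠ : Formula
  ⊤ᶠ = ↑ ≐ ↑

  _⇒_ : Formula → Formula → Formula
  φ ⇒ ψ = ¬ᶠ (φ ∧ᶠ ¬ᶠ ψ)

  _⇔_ : Formula → Formula → Formula
  φ ⇔ ψ = (φ ⇒ ψ) ∧ᶠ (ψ ⇒ φ)

  _↑ᶠ : Term → Formula
  x ↑ᶠ = x ≐ ↑

  _↓ᶠ : Term → Formula
  x ↓ᶠ = ¬ᶠ (x ↑ᶠ)

  ⋀ : List Formula → Formula
  ⋀ []       = ⊤ᶠ
  ⋀ (φ ∷ φs) = φ ∧ᶠ ⋀ φs

  _≐⃗_ : ∀ {n} → Vec Term n → Vec Term n → Formula
  xs ≐⃗ ys = ⋀ (Vec.toList (Vec.zipWith _≐_ xs ys))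

  Kᶿ : Group → Formula → Formula → Formula
  Kᶿ A θ φ = K A (θ ⇒ φ)

  KTᶿ : Group → Formula → Term → Formula
  KTᶿ A θ x = Kᶿ A θ (x ≐ restr x A θ)

  KVᶿ : ∀ {n} → Group → Formula → Vec Term n → Formula
  KVᶿ A θ xs = ⋀ (Vec.toList (Vec.map (KTᶿ A θ) xs))

  KT : Group → Term → Formula
  KT A x = KTᶿ A ⊤ᶠ x

  ⟨K⟩ : Group → Formula → Formula
  ⟨K⟩ A φ = ¬ᶠ K A (¬ᶠ φ)

  ⟨_⟩ᶠ_ : Event → Formula → Formula
  ⟨ e ⟩ᶠ φ = ¬ᶠ box e (¬ᶠ φ)

  pre : Event → Formula
  pre (mkEvent Φ _ _ _ _) = ⋀ Φ

  post : Event → Var → Term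
  post (mkEvent _ σv _ _ _) = σv

  evAg : Event → Agent → Group
  evAg (mkEvent _ _ σa _ _) = σa

  evGroup : Event → Group → Group
  evGroup e A = L⁺.concatMap (evAg e) A

  evSuper : Event → SuperGroup → SuperGroup
  evSuper e 𝔄 = L⁺.map (evGroup e) 𝔄

  evFormulas : Event → List Formula
  evFormulas (mkEvent Φ _ _ _ _) = Φ

  data PForm : Set where
    patom : ℕ → PForm
    pneg  : PForm → PForm
    pand  : PForm → PForm → PForm

  peval : (ℕ → Bool) → PForm → Bool
  peval ρ (patom i)  = ρ i
  peval ρ (pneg p)   = not (peval ρ p)
  peval ρ (pand p q) = peval ρ p ∧ peval ρ q

  Tautology : PForm → Set
  Tautology p = ∀ ρ → peval ρ p ≡ true

  psubst : (ℕ → Formula) → PForm → Formula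
  psubst s (patom i)  = s i
  psubst s (pneg p)   = ¬ᶠ psubst s p
  psubst s (pand p q) = psubst s p ∧ᶠ psubst s q

  infix 2 ⊢_

  data ⊢_ : Formula → Set where
    -- (I)
    taut : ∀ p → Tautology p → (s : ℕ → Formula) → ⊢ psubst s p
    mp   : ∀ {φ ψ} → ⊢ φ → ⊢ (φ ⇒ ψ) → ⊢ ψ
    -- (II)
    eq-refl : ∀ x → ⊢ x ≐ x
    eq-pred : ∀ {n m} (P : Pred (n + m)) (xs ys : Vec Term n) (zs : Vec Term m)
            → ⊢ (xs ≐⃗ ys) ⇒ (pred P (xs ++ zs) ⇔ pred P (ys ++ zs))
    eq-fun  : ∀ {n} (F : Func n) (xs ys : Vec Term n)
            → ⊢ (xs ≐⃗ ys) ⇒ fun F xs ≐ fun F ys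
    cond-ax : ∀ φ x y
            → ⊢ (φ ⇒ cond x φ y ≐ x) ∧ᶠ (¬ᶠ φ ⇒ cond x φ y ≐ y)
    -- (III)
    K-nec  : ∀ A {φ} → ⊢ φ → ⊢ K A φ
    K-dist : ∀ A φ ψ → ⊢ K A (φ ⇒ ψ) ⇒ (K A φ ⇒ K A ψ)
    K-T    : ∀ A φ → ⊢ K A φ ⇒ φ
    K-4    : ∀ A φ → ⊢ K A φ ⇒ K A (K A φ)
    K-5    : ∀ A φ → ⊢ ¬ᶠ K A φ ⇒ K A (¬ᶠ K A φ)
    K-mono : ∀ (A B : Group) φ → L⁺.toList A ⊆ L⁺.toList B → ⊢ K A φ ⇒ K B φ
    -- (IV)
    C-nec  : ∀ 𝔄 θ {φ} → ⊢ φ → ⊢ C 𝔄 θ φ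
    C-dist : ∀ 𝔄 θ φ ψ → ⊢ C 𝔄 θ (φ ⇒ ψ) ⇒ (C 𝔄 θ φ ⇒ C 𝔄 θ ψ)
    C-fix  : ∀ 𝔄 θ φ
           → ⊢ C 𝔄 θ φ ⇒ (φ ∧ᶠ ⋀ (L⁺.toList (L⁺.map (λ A → Kᶿ A θ (C 𝔄 θ φ)) 𝔄)))
    C-ind  : ∀ 𝔄 θ φ
           → ⊢ C 𝔄 θ (φ ⇒ ⋀ (L⁺.toList (L⁺.map (λ A → Kᶿ A θ φ) 𝔄))) ⇒ (φ ⇒ C 𝔄 θ φ)
    -- (V)
    restr-def : ∀ x A φ → ⊢ restr x A φ ↓ᶠ ⇒ (KTᶿ A φ x ∧ᶠ ⟨K⟩ A φ)
    K-const-var : ∀ a c v → owner v ≡ a → ⊢ KT [ a ] (const c) ∧ᶠ KT [ a ] (var v)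
    K-restr : ∀ x A φ → ⊢ KT A (restr x A φ)
    K-pred  : ∀ {n} A (P : Pred n) (xs : Vec Term n)
            → ⊢ KVᶿ A ⊤ᶠ xs ⇒ (pred P xs ⇒ K A (pred P xs))
    K-fun   : ∀ {n} A φ (F : Func n) (xs : Vec Term n)
            → ⊢ KVᶿ A φ xs ⇒ KTᶿ A φ (fun F xs)
    K-eq    : ∀ A θ x y → ⊢ Kᶿ A θ (x ≐ y) ⇒ (KTᶿ A θ x ⇒ KTᶿ A θ y)
    K-weak  : ∀ A φ θ x → ⊢ K A (φ ⇒ θ) ⇒ (KTᶿ A θ x ⇒ KTᶿ A φ x)
    -- (VI)
    box-nec  : ∀ e {φ} → ⊢ φ → ⊢ box e φ
    box-dist : ∀ e φ ψ → ⊢ box e (φ ⇒ ψ) ⇒ (box e φ ⇒ box e ψ)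
    box-pred : ∀ e {n} (P : Pred n) (xs : Vec Term n)
             → ⊢ box e (pred P xs) ⇔ (pre e ⇒ pred P (Vec.map (app e) xs))
    box-neg  : ∀ e φ → ⊢ box e (¬ᶠ φ) ⇔ (pre e ⇒ ¬ᶠ box e φ)
    box-K    : ∀ e A φ → ⊢ box e (K A φ) ⇔ (pre e ⇒ K (evGroup e A) (box e φ))
    box-C    : ∀ e 𝔄 θ φ
             → ⊢ box e (C 𝔄 θ φ) ⇔ (pre e ⇒ C (evSuper e 𝔄) (⟨ e ⟩ᶠ θ) (box e φ))
    -- (VII)
    app-def   : ∀ e x → ⊢ app e x ↓ᶠ ⇒ pre e
    app-const : ∀ e c → ⊢ pre e ⇒ app e (const c) ≐ const c
    app-var   : ∀ e v → ⊢ pre e ⇒ app e (var v) ≐ post e v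
    app-cond  : ∀ e x φ y
              → ⊢ pre e ⇒ app e (cond x φ y) ≐ cond (app e x) (⟨ e ⟩ᶠ φ) (app e y)
    app-fun   : ∀ e {n} (F : Func n) (xs : Vec Term n)
              → ⊢ pre e ⇒ app e (fun F xs) ≐ fun F (Vec.map (app e) xs)
    app-restr : ∀ e x A φ
              → ⊢ pre e ⇒ app e (restr x A φ) ≐ restr (app e x) (evGroup e A) (⟨ e ⟩ᶠ φ)

  -- The static fragment LKV (no [e]φ, no e(x))

  data StaticT : Term → Set
  data StaticF : Formula → Set

  data StaticT where
    s-const : ∀ c → StaticT (const c)
    s-var   : ∀ v → StaticT (var v)
    s-cond  : ∀ {x φ y} → StaticT x → StaticF φ → StaticT y → StaticT (cond x φ y)
    s-fun   : ∀ {n} {F : Func n} {xs} → VAll.All StaticT xs → StaticT (fun F xs)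
    s-restr : ∀ {x A φ} → StaticT x → StaticF φ → StaticT (restr x A φ)

  data StaticF where
    s-pred : ∀ {n} {P : Pred n} {xs} → VAll.All StaticT xs → StaticF (pred P xs)
    s-neg  : ∀ {φ} → StaticF φ → StaticF (¬ᶠ φ)
    s-and  : ∀ {φ ψ} → StaticF φ → StaticF ψ → StaticF (φ ∧ᶠ ψ)
    s-K    : ∀ {A φ} → StaticF φ → StaticF (K A φ)
    s-C    : ∀ {𝔄 θ φ} → StaticF θ → StaticF φ → StaticF (C 𝔄 θ φ)

  ReducibleF : Formula → Set
  ReducibleF θ = Σ Formula λ θ' → StaticF θ' × (⊢ θ ⇔ θ')

  ReducibleT : Term → Set
  ReducibleT x = Σ Term λ x' → StaticT x' × (⊢ x ≐ x')

  ReducibleE : Event → Set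
  ReducibleE e = All ReducibleF (evFormulas e) × (∀ v → ReducibleT (post e v))

-- The reduction axioms (VI) and (VII) push [e] and e(·) one step into a static formula or term,
-- rewriting it by static constructors over pre e, post e, and [e], ⟨e⟩ = ¬[e]¬ or e(·) applied to
-- its immediate constituents; so a simultaneous induction on static formulas and terms removes
-- them. The term axioms only hold under pre e, but outside pre e the term e(x) is undefined, so
-- e(x) = X|_{pre e}↑ for the term X they produce. The induction needs reducibility to be a
-- congruence for the static constructors; the non-trivial cases are the condition θ of C_𝔄^θ,
-- which follows from the induction axiom of C, and the restriction x_A^φ, which follows from S5
-- together with the knowledge axioms (V).

{-# OPTIONS --safe #-}
module Submission where

open import Defs
open import Data.Bool using (Bool; true; false; not; _∧_; T)
open import Data.Bool.Properties using (T-∧; T-≡)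
open import Data.List using (List; []; _∷_)
import Data.List as List
open import Data.List.NonEmpty as L⁺ using (_∷_)
open import Data.List.Relation.Unary.All using (All; []; _∷_)
open import Data.Nat using (ℕ; zero; suc; _<ᵇ_)
open import Data.Nat.Properties using (+-identityʳ)
open import Data.Product using (Σ; _×_; _,_; proj₁; proj₂)
open import Data.Vec as Vec using (Vec; []; _∷_; _++_)
open import Data.Vec.Properties using (subst-is-cast; ++-identityʳ-eqFree)
open import Data.Vec.Relation.Unary.All as VAll using ()
open import Function using (_∘_)
open import Function.Bundles using (Equivalence)
open import Relation.Binary.PropositionalEquality
  using (_≡_; refl; sym; trans; cong; cong₂; subst; subst₂)
import Relation.Binary.Reasoning.Base.Single as Single

module _ (𝒱 : Vocab) where
  open Vocab 𝒱
  open Syntax 𝒱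

  private variable
    n : ℕ
    φ φ′ ψ ψ′ χ θ θ′ : Formula
    x x′ y y′ z : Term
    A : Group
    𝔄 : SuperGroup
    e : Event

  -- Truth tables

  atomsBelow : ℕ → PForm → Bool
  atomsBelow n (patom i)  = i <ᵇ n
  atomsBelow n (pneg p)   = atomsBelow n p
  atomsBelow n (pand p q) = atomsBelow n p ∧ atomsBelow n q

  every : ∀ n → (Vec Bool n → Bool) → Bool
  every zero    f = f []
  every (suc n) f = every n (f ∘ (true ∷_)) ∧ every n (f ∘ (false ∷_))

  every-sound : ∀ n f → T (every n f) → ∀ bs → T (f bs)
  every-sound zero    f h []           = h
  every-sound (suc n) f h (true ∷ bs)  = every-sound n _ (proj₁ (Equivalence.to T-∧ h)) bs
  every-sound (suc n) f h (false ∷ bs) = every-sound n _ (proj₂ (Equivalence.to T-∧ h)) bs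

  valuation : Vec Bool n → ℕ → Bool
  valuation []       _       = false
  valuation (b ∷ bs) zero    = b
  valuation (b ∷ bs) (suc i) = valuation bs i

  restrict : ∀ n → (ℕ → Bool) → Vec Bool n
  restrict zero    ρ = []
  restrict (suc n) ρ = ρ 0 ∷ restrict n (ρ ∘ suc)

  valuation-restrict : ∀ n ρ i → T (i <ᵇ n) → valuation (restrict n ρ) i ≡ ρ i
  valuation-restrict (suc n) ρ zero    _ = refl
  valuation-restrict (suc n) ρ (suc i) h = valuation-restrict n (ρ ∘ suc) i h

  peval-restrict : ∀ n ρ p → T (atomsBelow n p) → peval (valuation (restrict n ρ)) p ≡ peval ρ p
  peval-restrict n ρ (patom i)  h = valuation-restrict n ρ i h
  peval-restrict n ρ (pneg p)   h = cong not (peval-restrict n ρ p h)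
  peval-restrict n ρ (pand p q) h =
    let (hp , hq) = Equivalence.to T-∧ h
    in cong₂ _∧_ (peval-restrict n ρ p hp) (peval-restrict n ρ q hq)

  truth-table : ∀ n p → T (atomsBelow n p) → T (every n (λ bs → peval (valuation bs) p)) →
                Tautology p
  truth-table n p below valid ρ =
    trans (sym (peval-restrict n ρ p below))
          (Equivalence.to T-≡ (every-sound n _ valid (restrict n ρ)))

  -- The default ⊤ᶠ is never reached: tautology checks that every atom indexes into the vector.
  substitution : Vec Formula n → ℕ → Formula
  substitution []       _       = ⊤ᶠ
  substitution (φ ∷ φs) zero    = φ
  substitution (φ ∷ φs) (suc i) = substitution φs i

  tautology : (p : PForm) (φs : Vec Formula n)
            → {_ : T (atomsBelow n p)} {_ : T (every n (λ bs → peval (valuation bs) p))}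
            → ⊢ psubst (substitution φs) p
  tautology {n} p φs {below} {valid} = taut p (truth-table n p below valid) (substitution φs)

  infixr 4 _⇒ᵖ_
  infixl 6 _∧ᵖ_
  infix  5 _⇔ᵖ_

  _⇒ᵖ_ _∧ᵖ_ _⇔ᵖ_ : PForm → PForm → PForm
  p ⇒ᵖ q = pneg (pand p (pneg q))
  p ∧ᵖ q = pand p q
  p ⇔ᵖ q = (p ⇒ᵖ q) ∧ᵖ (q ⇒ᵖ p)

  ¬ᵖ_ : PForm → PForm
  ¬ᵖ_ = pneg

  p₀ p₁ p₂ p₃ p₄ : PForm
  p₀ = patom 0
  p₁ = patom 1
  p₂ = patom 2
  p₃ = patom 3
  p₄ = patom 4

  infixl 5 _·_
  _·_ : ⊢ φ ⇒ ψ → ⊢ φ → ⊢ ψ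
  f · a = mp a f

  weaken : ⊢ ψ → ⊢ φ ⇒ ψ
  weaken h = tautology (p₀ ⇒ᵖ p₁ ⇒ᵖ p₀) (_ ∷ _ ∷ []) · h

  ⇒-refl : ⊢ φ ⇒ φ
  ⇒-refl = tautology (p₀ ⇒ᵖ p₀) (_ ∷ [])

  ⇒-trans : ⊢ φ ⇒ ψ → ⊢ ψ ⇒ χ → ⊢ φ ⇒ χ
  ⇒-trans f g = tautology ((p₀ ⇒ᵖ p₁) ⇒ᵖ (p₁ ⇒ᵖ p₂) ⇒ᵖ p₀ ⇒ᵖ p₂) (_ ∷ _ ∷ _ ∷ []) · f · g

  ⇒-mp : ⊢ φ ⇒ ψ → ⊢ φ ⇒ (ψ ⇒ χ) → ⊢ φ ⇒ χ
  ⇒-mp f g = tautology ((p₀ ⇒ᵖ p₁) ⇒ᵖ (p₀ ⇒ᵖ p₁ ⇒ᵖ p₂) ⇒ᵖ p₀ ⇒ᵖ p₂) (_ ∷ _ ∷ _ ∷ []) · f · g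

  ⇒-swap : ⊢ φ ⇒ (ψ ⇒ χ) → ⊢ ψ ⇒ (φ ⇒ χ)
  ⇒-swap f = tautology ((p₀ ⇒ᵖ p₁ ⇒ᵖ p₂) ⇒ᵖ p₁ ⇒ᵖ p₀ ⇒ᵖ p₂) (_ ∷ _ ∷ _ ∷ []) · f

  ⇒-uncurry : ⊢ φ ⇒ (ψ ⇒ χ) → ⊢ φ ∧ᶠ ψ ⇒ χ
  ⇒-uncurry f = tautology ((p₀ ⇒ᵖ p₁ ⇒ᵖ p₂) ⇒ᵖ p₀ ∧ᵖ p₁ ⇒ᵖ p₂) (_ ∷ _ ∷ _ ∷ []) · f

  ⇒-mono : ⊢ φ′ ⇒ φ → ⊢ ψ ⇒ ψ′ → ⊢ (φ ⇒ ψ) ⇒ (φ′ ⇒ ψ′)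
  ⇒-mono f g =
    tautology ((p₁ ⇒ᵖ p₀) ⇒ᵖ (p₂ ⇒ᵖ p₃) ⇒ᵖ (p₀ ⇒ᵖ p₂) ⇒ᵖ p₁ ⇒ᵖ p₃) (_ ∷ _ ∷ _ ∷ _ ∷ []) · f · g

  ⇒-distrib : ⊢ ψ ⇒ (χ ⇒ θ) → ⊢ (φ ⇒ ψ) ⇒ ((φ ⇒ χ) ⇒ (φ ⇒ θ))
  ⇒-distrib f =
    tautology ((p₁ ⇒ᵖ p₂ ⇒ᵖ p₃) ⇒ᵖ (p₀ ⇒ᵖ p₁) ⇒ᵖ (p₀ ⇒ᵖ p₂) ⇒ᵖ p₀ ⇒ᵖ p₃) (_ ∷ _ ∷ _ ∷ _ ∷ []) · f

  ∧-intro : ⊢ φ → ⊢ ψ → ⊢ φ ∧ᶠ ψ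
  ∧-intro a b = tautology (p₀ ⇒ᵖ p₁ ⇒ᵖ p₀ ∧ᵖ p₁) (_ ∷ _ ∷ []) · a · b

  ∧-projˡ : ⊢ φ ∧ᶠ ψ ⇒ φ
  ∧-projˡ = tautology (p₀ ∧ᵖ p₁ ⇒ᵖ p₀) (_ ∷ _ ∷ [])

  ∧-projʳ : ⊢ φ ∧ᶠ ψ ⇒ ψ
  ∧-projʳ = tautology (p₀ ∧ᵖ p₁ ⇒ᵖ p₁) (_ ∷ _ ∷ [])

  ∧-mono : ⊢ φ ⇒ φ′ → ⊢ ψ ⇒ ψ′ → ⊢ φ ∧ᶠ ψ ⇒ φ′ ∧ᶠ ψ′
  ∧-mono f g =
    tautology ((p₀ ⇒ᵖ p₁) ⇒ᵖ (p₂ ⇒ᵖ p₃) ⇒ᵖ p₀ ∧ᵖ p₂ ⇒ᵖ p₁ ∧ᵖ p₃) (_ ∷ _ ∷ _ ∷ _ ∷ []) · f · g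

  by-cases : ⊢ φ ⇒ ψ → ⊢ ¬ᶠ φ ⇒ ψ → ⊢ ψ
  by-cases f g = tautology ((p₀ ⇒ᵖ p₁) ⇒ᵖ (¬ᵖ p₀ ⇒ᵖ p₁) ⇒ᵖ p₁) (_ ∷ _ ∷ []) · f · g

  contraposition : ⊢ φ ⇒ ψ → ⊢ ¬ᶠ ψ ⇒ ¬ᶠ φ
  contraposition f = tautology ((p₀ ⇒ᵖ p₁) ⇒ᵖ ¬ᵖ p₁ ⇒ᵖ ¬ᵖ p₀) (_ ∷ _ ∷ []) · f

  contraposition-¬ : ⊢ ¬ᶠ φ ⇒ ψ → ⊢ ¬ᶠ ψ ⇒ φ
  contraposition-¬ f = tautology ((¬ᵖ p₀ ⇒ᵖ p₁) ⇒ᵖ ¬ᵖ p₁ ⇒ᵖ p₀) (_ ∷ _ ∷ []) · f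

  contraposition-under : ⊢ χ ⇒ (φ ⇒ ψ) → ⊢ χ ⇒ (¬ᶠ ψ ⇒ ¬ᶠ φ)
  contraposition-under f =
    tautology ((p₀ ⇒ᵖ p₁ ⇒ᵖ p₂) ⇒ᵖ p₀ ⇒ᵖ ¬ᵖ p₂ ⇒ᵖ ¬ᵖ p₁) (_ ∷ _ ∷ _ ∷ []) · f

  ⇒-pair : ⊢ χ ⇒ φ → ⊢ χ ⇒ ψ → ⊢ χ ⇒ φ ∧ᶠ ψ
  ⇒-pair f g =
    tautology ((p₀ ⇒ᵖ p₁) ⇒ᵖ (p₀ ⇒ᵖ p₂) ⇒ᵖ p₀ ⇒ᵖ p₁ ∧ᵖ p₂) (_ ∷ _ ∷ _ ∷ []) · f · g

  ⇔-to : ⊢ φ ⇔ ψ → ⊢ φ ⇒ ψ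
  ⇔-to h = ∧-projˡ · h

  ⇔-from : ⊢ φ ⇔ ψ → ⊢ ψ ⇒ φ
  ⇔-from h = ∧-projʳ · h

  ⇔-refl : ⊢ φ ⇔ φ
  ⇔-refl = ∧-intro ⇒-refl ⇒-refl

  ⇔-sym : ⊢ φ ⇔ ψ → ⊢ ψ ⇔ φ
  ⇔-sym h = ∧-intro (⇔-from h) (⇔-to h)

  ⇔-trans : ⊢ φ ⇔ ψ → ⊢ ψ ⇔ χ → ⊢ φ ⇔ χ
  ⇔-trans f g = ∧-intro (⇒-trans (⇔-to f) (⇔-to g)) (⇒-trans (⇔-from g) (⇔-from f))

  ¬-cong : ⊢ φ ⇔ ψ → ⊢ ¬ᶠ φ ⇔ ¬ᶠ ψ
  ¬-cong h = ∧-intro (contraposition (⇔-from h)) (contraposition (⇔-to h))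

  ∧-cong : ⊢ φ ⇔ φ′ → ⊢ ψ ⇔ ψ′ → ⊢ φ ∧ᶠ ψ ⇔ φ′ ∧ᶠ ψ′
  ∧-cong f g = ∧-intro (∧-mono (⇔-to f) (⇔-to g)) (∧-mono (⇔-from f) (⇔-from g))

  module ⇒-Reasoning = Single (λ φ ψ → ⊢ φ ⇒ ψ) ⇒-refl ⇒-trans

  ⊤-intro : ⊢ ⊤ᶠ
  ⊤-intro = eq-refl ↑

  ≐-sym⇒ : ∀ x y → ⊢ x ≐ y ⇒ y ≐ x
  ≐-sym⇒ x y =
    tautology ((p₀ ∧ᵖ p₁ ⇒ᵖ (p₂ ⇔ᵖ p₃)) ⇒ᵖ p₁ ⇒ᵖ p₂ ⇒ᵖ p₀ ⇒ᵖ p₃)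
              (x ≐ y ∷ ⊤ᶠ ∷ x ≐ x ∷ y ≐ x ∷ [])
      · eq-pred eqP (x ∷ []) (y ∷ []) (x ∷ []) · ⊤-intro · eq-refl x

  ≐-trans⇒ : ∀ x y z → ⊢ x ≐ y ⇒ (y ≐ z ⇒ x ≐ z)
  ≐-trans⇒ x y z =
    tautology ((p₀ ⇒ᵖ p₁) ⇒ᵖ (p₁ ∧ᵖ p₂ ⇒ᵖ (p₃ ⇔ᵖ p₄)) ⇒ᵖ p₂ ⇒ᵖ p₀ ⇒ᵖ p₃ ⇒ᵖ p₄)
              (x ≐ y ∷ y ≐ x ∷ ⊤ᶠ ∷ y ≐ z ∷ x ≐ z ∷ [])
      · ≐-sym⇒ x y · eq-pred eqP (y ∷ []) (x ∷ []) (z ∷ []) · ⊤-intro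

  ≐-sym : ⊢ χ ⇒ x ≐ y → ⊢ χ ⇒ y ≐ x
  ≐-sym {x = x} {y} h = ⇒-trans h (≐-sym⇒ x y)

  ≐-trans : ⊢ χ ⇒ x ≐ y → ⊢ χ ⇒ y ≐ z → ⊢ χ ⇒ x ≐ z
  ≐-trans {x = x} {y} {z} f g = ⇒-mp g (⇒-mp f (weaken (≐-trans⇒ x y z)))

  pred-subst : ∀ {m} (m≡n : m ≡ n) (P : Pred n) (zs : Vec Term m) →
               pred (subst Pred (sym m≡n) P) zs ≡ pred P (subst (Vec Term) m≡n zs)
  pred-subst refl P zs = refl

  pred-++-[] : (P : Pred n) (xs : Vec Term n) →
               pred (subst Pred (sym (+-identityʳ n)) P) (xs ++ []) ≡ pred P xs
  pred-++-[] {n} P xs =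
    trans (pred-subst (+-identityʳ n) P (xs ++ []))
          (cong (pred P) (trans (subst-is-cast (+-identityʳ n) (xs ++ [])) (++-identityʳ-eqFree xs)))

  -- eq-pred only speaks of predicates of arity n + m; take m = 0 and transport along n + 0 ≡ n.
  pred-cong : (P : Pred n) (xs ys : Vec Term n) → ⊢ xs ≐⃗ ys ⇒ (pred P xs ⇔ pred P ys)
  pred-cong {n} P xs ys =
    subst₂ (λ Pxs Pys → ⊢ xs ≐⃗ ys ⇒ (Pxs ⇔ Pys)) (pred-++-[] P xs) (pred-++-[] P ys)
           (eq-pred (subst Pred (sym (+-identityʳ n)) P) xs ys [])

  cond-selectˡ : ⊢ φ ⇒ cond x φ y ≐ x
  cond-selectˡ {φ} {x} {y} = ∧-projˡ · cond-ax φ x y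

  cond-selectʳ : ⊢ ¬ᶠ φ ⇒ cond x φ y ≐ y
  cond-selectʳ {φ} {x} {y} = ∧-projʳ · cond-ax φ x y

  ≐-cond : ⊢ φ ⇒ z ≐ x → ⊢ ¬ᶠ φ ⇒ z ≐ y → ⊢ z ≐ cond x φ y
  ≐-cond f g = by-cases (≐-trans f (≐-sym cond-selectˡ)) (≐-trans g (≐-sym cond-selectʳ))

  cond-cong : ⊢ x ≐ x′ → ⊢ φ ⇔ φ′ → ⊢ y ≐ y′ → ⊢ cond x φ y ≐ cond x′ φ′ y′
  cond-cong hx hφ hy =
    ≐-cond (≐-trans (⇒-trans (⇔-from hφ) cond-selectˡ) (weaken hx))
           (≐-trans (⇒-trans (contraposition (⇔-to hφ)) cond-selectʳ) (weaken hy))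

  ≐-from-defined : ⊢ x ↓ᶠ ⇒ x ≐ y → ⊢ y ↓ᶠ ⇒ x ≐ y → ⊢ x ≐ y
  ≐-from-defined {x} {y} f g =
    tautology ((¬ᵖ p₀ ⇒ᵖ p₂) ⇒ᵖ (¬ᵖ p₁ ⇒ᵖ p₂) ⇒ᵖ (p₀ ⇒ᵖ p₁ ⇒ᵖ p₂) ⇒ᵖ p₂)
              (x ↑ᶠ ∷ y ↑ᶠ ∷ x ≐ y ∷ [])
      · f · g · ⇒-trans (≐-trans⇒ x ↑ y) (⇒-mono (≐-sym⇒ y ↑) ⇒-refl)

  K-map : ⊢ φ ⇒ ψ → ⊢ K A φ ⇒ K A ψ
  K-map {φ} {ψ} {A} h = K-dist A φ ψ · K-nec A h

  K-map₂ : ⊢ φ ⇒ (ψ ⇒ χ) → ⊢ K A φ ⇒ (K A ψ ⇒ K A χ)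
  K-map₂ {ψ = ψ} {χ} {A} h = ⇒-trans (K-map h) (K-dist A ψ χ)

  K-cong : ⊢ φ ⇔ ψ → ⊢ K A φ ⇔ K A ψ
  K-cong h = ∧-intro (K-map (⇔-to h)) (K-map (⇔-from h))

  ⟨K⟩-map : ⊢ φ ⇒ ψ → ⊢ ⟨K⟩ A φ ⇒ ⟨K⟩ A ψ
  ⟨K⟩-map h = contraposition (K-map (contraposition h))

  K-⟨K⟩ : ⊢ K A (φ ⇒ ψ) ⇒ (⟨K⟩ A φ ⇒ ⟨K⟩ A ψ)
  K-⟨K⟩ {A} {φ} {ψ} =
    contraposition-under (K-map₂ (tautology ((p₀ ⇒ᵖ p₁) ⇒ᵖ ¬ᵖ p₁ ⇒ᵖ ¬ᵖ p₀) (φ ∷ ψ ∷ [])))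

  ⟨K⟩-stable : ⊢ φ ⇒ K A φ → ⊢ ⟨K⟩ A φ ⇒ φ
  ⟨K⟩-stable {φ} {A} h = begin
    ⟨K⟩ A φ        ∼⟨ ⟨K⟩-map h ⟩
    ⟨K⟩ A (K A φ)  ∼⟨ contraposition-¬ (K-5 A φ) ⟩
    K A φ          ∼⟨ K-T A φ ⟩
    φ              ∎
    where open ⇒-Reasoning

  ≐-known : ⊢ KT A x → ⊢ KT A y → ⊢ x ≐ y ⇒ K A (x ≐ y)
  ≐-known {A} {x} {y} kx ky = K-pred A eqP (x ∷ y ∷ []) · ∧-intro kx (∧-intro ky ⊤-intro)

  restr-knownᶿ : ∀ x A φ ψ → ⊢ KTᶿ A ψ (restr x A φ)
  restr-knownᶿ x A φ ψ = K-weak A ψ ⊤ᶠ (restr x A φ) · K-nec A (weaken ⊤-intro) · K-restr x A φ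

  restr-transfer : ⊢ x ≐ x′ → ⊢ φ ⇔ φ′ →
    ⊢ K A (φ ⇒ x ≐ restr x A φ) ⇒ K A (φ′ ⇒ restr x A φ ≐ restr x′ A φ′)
  restr-transfer {x} {x′} {φ} {φ′} {A} hx hφ = begin
    K A (φ ⇒ x ≐ r)     ∼⟨ K-map (⇒-mono (⇔-from hφ) (≐-trans (≐-sym ⇒-refl) (weaken hx))) ⟩
    K A (φ′ ⇒ r ≐ x′)   ∼⟨ ⇒-mp (⇒-swap (K-eq A φ′ r x′) · restr-knownᶿ x A φ φ′)
                                 (K-map₂ (⇒-distrib (≐-trans⇒ r x′ r′))) ⟩
    K A (φ′ ⇒ r ≐ r′)   ∎
    where
    open ⇒-Reasoning
    r r′ : Term
    r  = restr x A φ
    r′ = restr x′ A φ′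

  -- Once defined, x_A^φ is the value A knows x to have wherever φ holds, and φ is possible for A.
  -- Then A knows x′ to be x′_A^φ′ wherever φ′ holds (K-eq), so the two restrictions agree at a
  -- world A deems possible; being known to A, they agree everywhere.
  restr-cong-if-defined : ⊢ x ≐ x′ → ⊢ φ ⇔ φ′ → ⊢ restr x A φ ↓ᶠ ⇒ restr x A φ ≐ restr x′ A φ′
  restr-cong-if-defined {x} {x′} {φ} {φ′} {A} hx hφ = begin
    r ↓ᶠ                            ∼⟨ restr-def x A φ ⟩
    K A (φ ⇒ x ≐ r) ∧ᶠ ⟨K⟩ A φ       ∼⟨ ∧-mono (restr-transfer hx hφ) (⟨K⟩-map (⇔-to hφ)) ⟩
    K A (φ′ ⇒ r ≐ r′) ∧ᶠ ⟨K⟩ A φ′    ∼⟨ ⇒-uncurry K-⟨K⟩ ⟩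
    ⟨K⟩ A (r ≐ r′)                  ∼⟨ ⟨K⟩-stable (≐-known (K-restr x A φ) (K-restr x′ A φ′)) ⟩
    r ≐ r′                          ∎
    where
    open ⇒-Reasoning
    r r′ : Term
    r  = restr x A φ
    r′ = restr x′ A φ′

  restr-cong : ⊢ x ≐ x′ → ⊢ φ ⇔ φ′ → ⊢ restr x A φ ≐ restr x′ A φ′
  restr-cong hx hφ =
    ≐-from-defined (restr-cong-if-defined hx hφ)
                   (≐-sym (restr-cong-if-defined (≐-sym⇒ _ _ · hx) (⇔-sym hφ)))

  box-map : ⊢ φ ⇒ ψ → ⊢ box e φ ⇒ box e ψ
  box-map {φ} {ψ} {e} h = box-dist e φ ψ · box-nec e h

  box-map₂ : ⊢ φ ⇒ (ψ ⇒ χ) → ⊢ box e φ ⇒ (box e ψ ⇒ box e χ)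
  box-map₂ {ψ = ψ} {χ} {e} h = ⇒-trans (box-map h) (box-dist e ψ χ)

  box-∧ : ⊢ box e (φ ∧ᶠ ψ) ⇔ box e φ ∧ᶠ box e ψ
  box-∧ {e} {φ} {ψ} =
    ∧-intro (⇒-pair (box-map ∧-projˡ) (box-map ∧-projʳ))
            (⇒-uncurry (box-map₂ (tautology (p₀ ⇒ᵖ p₁ ⇒ᵖ p₀ ∧ᵖ p₁) (φ ∷ ψ ∷ []))))

  C-map : ⊢ φ ⇒ ψ → ⊢ C 𝔄 θ φ ⇒ C 𝔄 θ ψ
  C-map {φ} {ψ} {𝔄} {θ} h = C-dist 𝔄 θ φ ψ · C-nec 𝔄 θ h

  ⋀-map-mono : {X : Set} (f g : X → Formula) (xs : List X) →
               (∀ a → ⊢ f a ⇒ g a) → ⊢ ⋀ (List.map f xs) ⇒ ⋀ (List.map g xs)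
  ⋀-map-mono f g []       h = ⇒-refl
  ⋀-map-mono f g (a ∷ xs) h = ∧-mono (h a) (⋀-map-mono f g xs h)

  ⋀⁺-map-mono : (f g : Group → Formula) (𝔄 : SuperGroup) → (∀ A → ⊢ f A ⇒ g A) →
                ⊢ ⋀ (L⁺.toList (L⁺.map f 𝔄)) ⇒ ⋀ (L⁺.toList (L⁺.map g 𝔄))
  ⋀⁺-map-mono f g (A ∷ As) = ⋀-map-mono f g (A ∷ As)

  -- C 𝔄 θ φ is itself closed under every K_A^θ′ with θ′ ⇒ θ, so the induction axiom applies to it.
  C-antitone : ⊢ θ′ ⇒ θ → ⊢ C 𝔄 θ φ ⇒ C 𝔄 θ′ φ
  C-antitone {θ′} {θ} {𝔄} {φ} h = begin
    Cφ          ∼⟨ C-ind 𝔄 θ′ Cφ · C-nec 𝔄 θ′ Cφ-closed ⟩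
    C 𝔄 θ′ Cφ   ∼⟨ C-map (⇒-trans (C-fix 𝔄 θ φ) ∧-projˡ) ⟩
    C 𝔄 θ′ φ    ∎
    where
    open ⇒-Reasoning
    Cφ : Formula
    Cφ = C 𝔄 θ φ
    Cφ-closed : ⊢ Cφ ⇒ ⋀ (L⁺.toList (L⁺.map (λ A → Kᶿ A θ′ Cφ) 𝔄))
    Cφ-closed = ⇒-trans (⇒-trans (C-fix 𝔄 θ φ) ∧-projʳ)
                        (⋀⁺-map-mono _ _ 𝔄 (λ A → K-map (⇒-mono h ⇒-refl)))

  C-cong : ⊢ θ ⇔ θ′ → ⊢ φ ⇔ φ′ → ⊢ C 𝔄 θ φ ⇔ C 𝔄 θ′ φ′
  C-cong hθ hφ = ∧-intro (⇒-trans (C-antitone (⇔-from hθ)) (C-map (⇔-to hφ)))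
                         (⇒-trans (C-antitone (⇔-to hθ)) (C-map (⇔-from hφ)))

  ⇔-reducible : ⊢ φ ⇔ ψ → ReducibleF ψ → ReducibleF φ
  ⇔-reducible h (ψ′ , sψ′ , hψ′) = ψ′ , sψ′ , ⇔-trans h hψ′

  ¬-reducible : ReducibleF φ → ReducibleF (¬ᶠ φ)
  ¬-reducible (φ′ , sφ′ , hφ′) = ¬ᶠ φ′ , s-neg sφ′ , ¬-cong hφ′

  ∧-reducible : ReducibleF φ → ReducibleF ψ → ReducibleF (φ ∧ᶠ ψ)
  ∧-reducible (φ′ , sφ′ , hφ′) (ψ′ , sψ′ , hψ′) = φ′ ∧ᶠ ψ′ , s-and sφ′ sψ′ , ∧-cong hφ′ hψ′

  ⇒-reducible : ReducibleF φ → ReducibleF ψ → ReducibleF (φ ⇒ ψ)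
  ⇒-reducible rφ rψ = ¬-reducible (∧-reducible rφ (¬-reducible rψ))

  ⋀-reducible : ∀ {Φ} → All ReducibleF Φ → ReducibleF (⋀ Φ)
  ⋀-reducible []         = ⊤ᶠ , s-pred (s-const cundef VAll.∷ s-const cundef VAll.∷ VAll.[]) , ⇔-refl
  ⋀-reducible (rφ ∷ rΦ) = ∧-reducible rφ (⋀-reducible rΦ)

  K-reducible : ReducibleF φ → ReducibleF (K A φ)
  K-reducible (φ′ , sφ′ , hφ′) = K _ φ′ , s-K sφ′ , K-cong hφ′

  C-reducible : ReducibleF θ → ReducibleF φ → ReducibleF (C 𝔄 θ φ)
  C-reducible (θ′ , sθ′ , hθ′) (φ′ , sφ′ , hφ′) = C _ θ′ φ′ , s-C sθ′ sφ′ , C-cong hθ′ hφ′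

  ≐-reducible : ⊢ x ≐ y → ReducibleT y → ReducibleT x
  ≐-reducible {x} {y} h (y′ , sy′ , hy′) = y′ , sy′ , ≐-trans⇒ x y y′ · h · hy′

  static-reducible : StaticT x → ReducibleT x
  static-reducible {x} sx = x , sx , eq-refl x

  cond-reducible : ReducibleT x → ReducibleF φ → ReducibleT y → ReducibleT (cond x φ y)
  cond-reducible (x′ , sx′ , hx′) (φ′ , sφ′ , hφ′) (y′ , sy′ , hy′) =
    cond x′ φ′ y′ , s-cond sx′ sφ′ sy′ , cond-cong hx′ hφ′ hy′

  restr-reducible : ReducibleT x → ReducibleF φ → ReducibleT (restr x A φ)
  restr-reducible (x′ , sx′ , hx′) (φ′ , sφ′ , hφ′) =
    restr x′ _ φ′ , s-restr sx′ sφ′ , restr-cong hx′ hφ′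

  pointwise-reduct : {xs : Vec Term n} → VAll.All ReducibleT xs →
                     Σ (Vec Term n) λ ys → VAll.All StaticT ys × ⊢ xs ≐⃗ ys
  pointwise-reduct VAll.[] = [] , VAll.[] , ⊤-intro
  pointwise-reduct ((x′ , sx′ , hx′) VAll.∷ rxs) =
    let (ys , sys , hys) = pointwise-reduct rxs in x′ ∷ ys , sx′ VAll.∷ sys , ∧-intro hx′ hys

  pred-reducible : (P : Pred n) {xs : Vec Term n} → VAll.All ReducibleT xs → ReducibleF (pred P xs)
  pred-reducible P {xs} rxs =
    let (ys , sys , hys) = pointwise-reduct rxs in pred P ys , s-pred sys , pred-cong P xs ys · hys

  fun-reducible : (F : Func n) {xs : Vec Term n} → VAll.All ReducibleT xs → ReducibleT (fun F xs)
  fun-reducible F {xs} rxs =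
    let (ys , sys , hys) = pointwise-reduct rxs in fun F ys , s-fun sys , eq-fun F xs ys · hys

  -- Outside pre e, e(x) is undefined by app-def.
  app-≐-cond : ⊢ pre e ⇒ app e x ≐ y → ⊢ app e x ≐ cond y (pre e) ↑
  app-≐-cond {e} {x} h = ≐-cond h (contraposition-¬ (app-def e x))

  pre-reducible : ∀ e → All ReducibleF (evFormulas e) → ReducibleF (pre e)
  pre-reducible (mkEvent Φ _ _ _ _) = ⋀-reducible

  module _ (e : Event) (pre-red : ReducibleF (pre e)) (post-red : ∀ v → ReducibleT (post e v)) where

    box-¬-reducible : ReducibleF (box e φ) → ReducibleF (box e (¬ᶠ φ))
    box-¬-reducible {φ} r = ⇔-reducible (box-neg e φ) (⇒-reducible pre-red (¬-reducible r))

    ◇-reducible : ReducibleF (box e φ) → ReducibleF (⟨ e ⟩ᶠ φ)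
    ◇-reducible r = ¬-reducible (box-¬-reducible r)

    app-reducible-via : ⊢ pre e ⇒ app e x ≐ y → ReducibleT y → ReducibleT (app e x)
    app-reducible-via h ry =
      ≐-reducible (app-≐-cond h) (cond-reducible ry pre-red (static-reducible (s-const cundef)))

    box-reducible : ∀ θ → StaticF θ → ReducibleF (box e θ)
    app-reducible : ∀ x → StaticT x → ReducibleT (app e x)
    apps-reducible : (xs : Vec Term n) → VAll.All StaticT xs → VAll.All ReducibleT (Vec.map (app e) xs)

    box-reducible (pred P xs) (s-pred sxs) =
      ⇔-reducible (box-pred e P xs) (⇒-reducible pre-red (pred-reducible P (apps-reducible xs sxs)))
    box-reducible (¬ᶠ φ) (s-neg sφ) = box-¬-reducible (box-reducible φ sφ)
    box-reducible (φ ∧ᶠ ψ) (s-and sφ sψ) =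
      ⇔-reducible box-∧ (∧-reducible (box-reducible φ sφ) (box-reducible ψ sψ))
    box-reducible (K A φ) (s-K sφ) =
      ⇔-reducible (box-K e A φ) (⇒-reducible pre-red (K-reducible (box-reducible φ sφ)))
    box-reducible (C 𝔄 θ φ) (s-C sθ sφ) =
      ⇔-reducible (box-C e 𝔄 θ φ)
        (⇒-reducible pre-red (C-reducible (◇-reducible (box-reducible θ sθ)) (box-reducible φ sφ)))

    app-reducible (const c) (s-const .c) =
      app-reducible-via (app-const e c) (static-reducible (s-const c))
    app-reducible (var v) (s-var .v) = app-reducible-via (app-var e v) (post-red v)
    app-reducible (cond x φ y) (s-cond sx sφ sy) =
      app-reducible-via (app-cond e x φ y)
        (cond-reducible (app-reducible x sx) (◇-reducible (box-reducible φ sφ)) (app-reducible y sy))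
    app-reducible (fun F xs) (s-fun sxs) =
      app-reducible-via (app-fun e F xs) (fun-reducible F (apps-reducible xs sxs))
    app-reducible (restr x A φ) (s-restr sx sφ) =
      app-reducible-via (app-restr e x A φ)
        (restr-reducible (app-reducible x sx) (◇-reducible (box-reducible φ sφ)))

    apps-reducible []       VAll.[]          = VAll.[]
    apps-reducible (x ∷ xs) (sx VAll.∷ sxs) = app-reducible x sx VAll.∷ apps-reducible xs sxs

lemma15 : (𝒱 : Vocab) → let open Syntax 𝒱 in
    (e : Event) → ReducibleE e →
      ((θ : Formula) → StaticF θ → ReducibleF (box e θ))
      × ((x : Term) → StaticT x → ReducibleT (app e x))
lemma15 𝒱 e (Φ-red , post-red) =
  box-reducible 𝒱 e pre-red post-red , app-reducible 𝒱 e pre-red post-red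
  where
  open Syntax 𝒱
  pre-red : ReducibleF (pre e)
  pre-red = pre-reducible 𝒱 e Φ-red
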